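{- Let a run of a timed causal transition system be given in which, for each event $z$, the clock $c_z$ is reset to $0$ exactly at the global time $s_z$ when the transition carrying event $z$ (the start of the corresponding action) is taken, so that at global time $t\ge s_z$ its value is $c_z=t-s_z$. Let $E$ be a nonempty finite set of pairs $z{:}a$ (event $z$ attached to action $a$) all of whose transitions have occurred, and for $z{:}a\in E$ let $\tau_z=s_z+\mathrm{dur}(a)$ be the termination time of that action; let $\tau=\max_{z:a\in E}\tau_z$. Let $u,d\in\mathbb{R}^+$ and consider a transition $s_1 \xrightarrow{\langle {}_E b_x,\ \mathcal{F}^{\le u}(E)+d,\ c_x\rangle} s_2$. Then the clock constraint $\mathcal{F}^{\le u}(E)+d$ is satisfied at global time $t$ (i.e. the action $b$ is enabled at time $t$) if and only if $t\in[\tau+d,\ \tau+d+u]$.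
   Context: Each action $a$ has a fixed duration $\mathrm{dur}(a)\in\mathbb{R}^+$. Clocks are $c_z$ for events $z$. Timed constraints are built by $\varphi::=\varphi\wedge\varphi\mid\varphi\vee\varphi\mid c_z\prec c\mid c\prec c_z$ with $\prec\in\{<,\le\}$, $c\in\mathbb{R}^+$. For a finite set $E$ of event–action pairs, $\mathcal{F}^{\le u}(E)=\bigwedge_{z:a\in E}(\mathrm{dur}(a)\le c_z)\ \wedge\ \bigvee_{z:a\in E}(c_z\le \mathrm{dur}(a)+u)$. The delay of a constraint by $d$ is defined inductively: $(\varphi_1\wedge\varphi_2)+d=(\varphi_1+d)\wedge(\varphi_2+d)$, $(\varphi_1\vee\varphi_2)+d=(\varphi_1+d)\vee(\varphi_2+d)$, $(\alpha\le c_z)+d=(\alpha+d\le c_z)$, $(c_z\le\beta)+d=(c_z\le\beta+d)$. A transition labelled $\langle {}_Eb_x,\varphi,\lambda\rangle$ of a timed causal transition system can be taken from a configuration with clock valuation $\nu$ only if $\nu$ satisfies $\varphi$; upon taking it the clocks in $\lambda$ are reset to $0$. -}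

module Defs where

open import Level using (Level; _⊔_; suc)
open import Data.Product using (_×_; Σ; _,_)
open import Data.Sum using (_⊎_)
open import Data.List.NonEmpty using (List⁺; _∷_; foldr₁; map)
open import Data.List.NonEmpty using (toList)
open import Data.List.Membership.Propositional using (_∈_)
open import Relation.Binary.PropositionalEquality using (_≡_)
open import Relation.Binary.Structures using (IsTotalOrder)
open import Algebra.Structures using (IsAbelianGroup)
open import Relation.Nullary using (¬_)

-- Time domain: a linearly ordered abelian group (ℝ with + and ≤ is one).
-- Stating the lemma for every such structure covers the paper's ℝ.

record OrderedTime (c ℓ : Level) : Set (suc (c ⊔ ℓ)) where
  infixl 6 _+_ _-_
  infix 4 _≤_ _<_
  field
    T         : Set c
    _+_       : T → T → T
    0#        : T
    -_        : T → T
    _≤_       : T → T → Set ℓ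
    isAbelianGroup : IsAbelianGroup _≡_ _+_ 0# -_
    isTotalOrder   : IsTotalOrder _≡_ _≤_
    +-mono-≤  : ∀ {x y} z → x ≤ y → x + z ≤ y + z

  _-_ : T → T → T
  x - y = x + (- y)

  _<_ : T → T → Set (c ⊔ ℓ)
  x < y = (x ≤ y) × ¬ (x ≡ y)

  Pos : T → Set (c ⊔ ℓ)
  Pos x = 0# < x

_∈⁺_ : ∀ {a} {A : Set a} → A → List⁺ A → Set a
x ∈⁺ xs = x ∈ toList xs

module Timed {c ℓ : Level} (O : OrderedTime c ℓ) (Event : Set) where
  open OrderedTime O

  data Cmp : Set where
    lt le : Cmp

  ⟦_⟧ : Cmp → T → T → Set (c ⊔ ℓ)
  ⟦ lt ⟧ x y = x < y
  ⟦ le ⟧ x y = Level.Lift c (x ≤ y)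

  data Constraint : Set c where
    _∧_  : Constraint → Constraint → Constraint
    _∨_  : Constraint → Constraint → Constraint
    clk≺ : Event → Cmp → T → Constraint
    ≺clk : T → Cmp → Event → Constraint

  Valuation : Set c
  Valuation = Event → T

  _⊨_ : Valuation → Constraint → Set (c ⊔ ℓ)
  ν ⊨ (φ ∧ ψ)      = (ν ⊨ φ) × (ν ⊨ ψ)
  ν ⊨ (φ ∨ ψ)      = (ν ⊨ φ) ⊎ (ν ⊨ ψ)
  ν ⊨ clk≺ z p k   = ⟦ p ⟧ (ν z) k
  ν ⊨ ≺clk k p z   = ⟦ p ⟧ k (ν z)

  _+ᶜ_ : Constraint → T → Constraint
  (φ ∧ ψ) +ᶜ d     = (φ +ᶜ d) ∧ (ψ +ᶜ d)
  (φ ∨ ψ) +ᶜ d     = (φ +ᶜ d) ∨ (ψ +ᶜ d)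
  clk≺ z p k +ᶜ d  = clk≺ z p (k + d)
  ≺clk k p z +ᶜ d  = ≺clk (k + d) p z

  module _ {Action : Set} (dur : Action → T) where
    lowerC : Event × Action → Constraint
    lowerC (z , a) = ≺clk (dur a) le z

    upperC : T → Event × Action → Constraint
    upperC u (z , a) = clk≺ z le (dur a + u)

    F≤ : T → List⁺ (Event × Action) → Constraint
    F≤ u E = foldr₁ _∧_ (map lowerC E) ∧ foldr₁ _∨_ (map (upperC u) E)

  IsMax : T → List⁺ T → Set (c ⊔ ℓ)
  IsMax τ xs = (τ ∈⁺ xs) × (∀ {x} → x ∈⁺ xs → Level.Lift c (x ≤ τ))

module Submission where

-- The proof splits F^{≤u}(E) + d
-- into its conjunction of lower bounds and its disjunction of upper bounds.
--   1. Ordered-group arithmetic: a bound on a clock t - s_z transposes to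
--      a bound on t (≤-transposeʳ, ≤-transposeˡ).
--   2. Delay commutes with the folds building F^{≤u}(E) (delay-foldr₁), and
--      a folded conjunction (disjunction) holds iff all (some) conjuncts
--      (disjuncts) hold (⊨-⋀, ⊨-⋁).
--   3. Maxima: every f(τ_z) is below t iff f(τ) is, and some f(τ_z) is above
--      t iff f(τ) is, for monotone f (all-below-max, some-above-max).
-- Combining these, the lower bounds say exactly τ + d ≤ t (lower-bounds-⇔)
-- and the upper bounds say exactly t ≤ τ + d + u (upper-bounds-⇔).

open import Defs
open import Level using (Lift; lift; lower; _⊔_)
open import Data.Product using (_×_; _,_; ∃-syntax)
open import Data.Sum using (inj₁; inj₂)
open import Data.Product.Function.NonDependent.Propositional using (_×-⇔_)
open import Data.List using ([]) renaming (_∷_ to _∷ₗ_)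
open import Data.List.NonEmpty using (List⁺; _∷_; map; foldr₁)
import Data.List.NonEmpty.Properties as List⁺
open import Data.List.Relation.Unary.Any using (here; there)
open import Data.List.Membership.Propositional.Properties using (∈-map⁺; ∈-map⁻)
open import Function.Base using (_∘_)
open import Function.Bundles using (_⇔_; mk⇔; Equivalence)
open import Function.Properties.Equivalence using () renaming (trans to ⇔-trans)
open import Relation.Binary.PropositionalEquality
  using (_≡_; refl; cong; subst; sym)
open Relation.Binary.PropositionalEquality.≡-Reasoning
open import Relation.Binary.Structures using (IsTotalOrder)
open import Algebra.Bundles using (AbelianGroup)
import Algebra.Properties.AbelianGroup as AbelianGroupProperties
import Algebra.Properties.CommutativeSemigroup as CommutativeSemigroupProperties

Lift-⇔ : ∀ {a} ℓ {A : Set a} → Lift ℓ A ⇔ A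
Lift-⇔ _ = mk⇔ lower lift

foldr₁-hom : ∀ {a} {A : Set a} (f : A → A) (_⊕_ : A → A → A) →
  (∀ x y → f (x ⊕ y) ≡ f x ⊕ f y) →
  (xs : List⁺ A) → f (foldr₁ _⊕_ xs) ≡ foldr₁ _⊕_ (map f xs)
foldr₁-hom f _⊕_ hom (x ∷ xs) = go x xs
  where
    go : ∀ x xs → f (foldr₁ _⊕_ (x ∷ xs)) ≡ foldr₁ _⊕_ (map f (x ∷ xs))
    go x []        = refl
    go x (y ∷ₗ ys) = begin
      f (x ⊕ foldr₁ _⊕_ (y ∷ ys))        ≡⟨ hom x _ ⟩
      f x ⊕ f (foldr₁ _⊕_ (y ∷ ys))      ≡⟨ cong (f x ⊕_) (go y ys) ⟩
      f x ⊕ foldr₁ _⊕_ (map f (y ∷ ys))  ∎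

module _ {c ℓ} (O : OrderedTime c ℓ) where
  open OrderedTime O

  ≤-trans : ∀ {x y z} → x ≤ y → y ≤ z → x ≤ z
  ≤-trans = IsTotalOrder.trans isTotalOrder

  abelianGroup : AbelianGroup c c
  abelianGroup = record
    { Carrier = T ; _≈_ = _≡_ ; _∙_ = _+_ ; ε = 0# ; _⁻¹ = -_
    ; isAbelianGroup = isAbelianGroup }

  open AbelianGroupProperties abelianGroup using (//-rightDividesˡ; //-rightDividesʳ)
  open CommutativeSemigroupProperties (AbelianGroup.commutativeSemigroup abelianGroup)
    using (xy∙z≈xz∙y; xy∙z≈zx∙y)

  ≤-shift : ∀ {x y} z → x ≤ y ⇔ x + z ≤ y + z
  ≤-shift {x} {y} z = mk⇔ (+-mono-≤ z) shift-back
    where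
      shift-back : x + z ≤ y + z → x ≤ y
      shift-back h = subst (_≤ y) (//-rightDividesʳ z x)
                       (subst (x + z - z ≤_) (//-rightDividesʳ z y) (+-mono-≤ (- z) h))

  ≤-transposeʳ : ∀ {x} y z → x ≤ y - z ⇔ x + z ≤ y
  ≤-transposeʳ {x} y z =
    subst (λ w → x ≤ y - z ⇔ x + z ≤ w) (//-rightDividesˡ z y) (≤-shift z)

  ≤-transposeˡ : ∀ x {y} z → y - z ≤ x ⇔ y ≤ x + z
  ≤-transposeˡ x {y} z =
    subst (λ w → y - z ≤ x ⇔ w ≤ x + z) (//-rightDividesˡ z y) (≤-shift z)

  lower-regroup : ∀ a d s → (a + d) + s ≡ (s + a) + d
  lower-regroup a d s = xy∙z≈zx∙y a d s

  upper-regroup : ∀ a u d s → ((a + u) + d) + s ≡ ((s + a) + d) + u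
  upper-regroup a u d s = begin
    ((a + u) + d) + s  ≡⟨ cong (_+ s) (xy∙z≈xz∙y a u d) ⟩
    ((a + d) + u) + s  ≡⟨ xy∙z≈xz∙y (a + d) u s ⟩
    ((a + d) + s) + u  ≡⟨ cong (_+ u) (lower-regroup a d s) ⟩
    ((s + a) + d) + u  ∎

  Monotone : (T → T) → Set (c ⊔ ℓ)
  Monotone f = ∀ {x y} → x ≤ y → f x ≤ f y

  module _ {Event : Set} where
    open Timed O Event

    all-below-max : {A : Set} (h : A → T) (E : List⁺ A) {τ : T} → IsMax τ (map h E) →
      (f : T → T) → Monotone f → (t : T) →
      (∀ {p} → p ∈⁺ E → f (h p) ≤ t) ⇔ f τ ≤ t
    all-below-max h (x ∷ xs) {τ} (τ∈ , τ-max) f f-mono t = mk⇔ to from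
      where
        to : (∀ {p} → p ∈⁺ (x ∷ xs) → f (h p) ≤ t) → f τ ≤ t
        to all with ∈-map⁻ h τ∈
        ... | p , p∈ , refl = all p∈
        from : f τ ≤ t → ∀ {p} → p ∈⁺ (x ∷ xs) → f (h p) ≤ t
        from fτ≤t p∈ = ≤-trans (f-mono (lower (τ-max (∈-map⁺ h p∈)))) fτ≤t

    some-above-max : {A : Set} (h : A → T) (E : List⁺ A) {τ : T} → IsMax τ (map h E) →
      (f : T → T) → Monotone f → (t : T) →
      (∃[ p ] (p ∈⁺ E × t ≤ f (h p))) ⇔ t ≤ f τ
    some-above-max h (x ∷ xs) {τ} (τ∈ , τ-max) f f-mono t = mk⇔ to from
      where
        to : ∃[ p ] (p ∈⁺ (x ∷ xs) × t ≤ f (h p)) → t ≤ f τ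
        to (p , p∈ , t≤) = ≤-trans t≤ (f-mono (lower (τ-max (∈-map⁺ h p∈))))
        from : t ≤ f τ → ∃[ p ] (p ∈⁺ (x ∷ xs) × t ≤ f (h p))
        from t≤ with ∈-map⁻ h τ∈
        ... | p , p∈ , refl = p , p∈ , t≤

    delay-foldr₁ : ∀ {A : Set} (_⊕_ : Constraint → Constraint → Constraint) (d : T) →
      (∀ φ ψ → (φ ⊕ ψ) +ᶜ d ≡ (φ +ᶜ d) ⊕ (ψ +ᶜ d)) →
      (g : A → Constraint) (E : List⁺ A) →
      foldr₁ _⊕_ (map g E) +ᶜ d ≡ foldr₁ _⊕_ (map ((_+ᶜ d) ∘ g) E)
    delay-foldr₁ _⊕_ d hom g E = begin
      foldr₁ _⊕_ (map g E) +ᶜ d               ≡⟨ foldr₁-hom (_+ᶜ d) _⊕_ hom (map g E) ⟩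
      foldr₁ _⊕_ (map (_+ᶜ d) (map g E))      ≡⟨ cong (foldr₁ _⊕_) (sym (List⁺.map-∘ E)) ⟩
      foldr₁ _⊕_ (map ((_+ᶜ d) ∘ g) E)        ∎

    ⊨-⋀ : ∀ {A : Set} (ν : Valuation) (g : A → Constraint) (E : List⁺ A) →
      ν ⊨ foldr₁ _∧_ (map g E) ⇔ (∀ {p} → p ∈⁺ E → ν ⊨ g p)
    ⊨-⋀ ν g E = mk⇔ (to E) (from E)
      where
        to : ∀ E → ν ⊨ foldr₁ _∧_ (map g E) → ∀ {p} → p ∈⁺ E → ν ⊨ g p
        to (x ∷ [])       h        (here refl) = h
        to (x ∷ y ∷ₗ ys) (hx , _)  (here refl) = hx
        to (x ∷ y ∷ₗ ys) (_ , hys) (there p∈)  = to (y ∷ ys) hys p∈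
        from : ∀ E → (∀ {p} → p ∈⁺ E → ν ⊨ g p) → ν ⊨ foldr₁ _∧_ (map g E)
        from (x ∷ xs) = go x xs
          where
            go : ∀ x xs → (∀ {p} → p ∈⁺ (x ∷ xs) → ν ⊨ g p) → ν ⊨ foldr₁ _∧_ (map g (x ∷ xs))
            go x []        all = all (here refl)
            go x (y ∷ₗ ys) all = all (here refl) , go y ys (all ∘ there)

    ⊨-⋁ : ∀ {A : Set} (ν : Valuation) (g : A → Constraint) (E : List⁺ A) →
      ν ⊨ foldr₁ _∨_ (map g E) ⇔ (∃[ p ] (p ∈⁺ E × ν ⊨ g p))
    ⊨-⋁ ν g E = mk⇔ (to E) (from E)
      where
        to : ∀ E → ν ⊨ foldr₁ _∨_ (map g E) → ∃[ p ] (p ∈⁺ E × ν ⊨ g p)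
        to (x ∷ [])       h        = x , here refl , h
        to (x ∷ y ∷ₗ ys) (inj₁ h) = x , here refl , h
        to (x ∷ y ∷ₗ ys) (inj₂ h) with to (y ∷ ys) h
        ... | p , p∈ , hp = p , there p∈ , hp
        from : ∀ E → ∃[ p ] (p ∈⁺ E × ν ⊨ g p) → ν ⊨ foldr₁ _∨_ (map g E)
        from (x ∷ [])       (p , here refl , h) = h
        from (x ∷ y ∷ₗ ys) (p , here refl , h) = inj₁ h
        from (x ∷ y ∷ₗ ys) (p , there p∈ , h)  = inj₂ (from (y ∷ ys) (p , p∈ , h))

    module _ {Action : Set} (dur : Action → T) (s : Event → T) (t : T) where

      clocks : Valuation
      clocks z = t - s z

      termination : Event × Action → T
      termination (z , a) = s z + dur a

      lower-bound-⇔ : ∀ d p → clocks ⊨ (lowerC dur p +ᶜ d) ⇔ termination p + d ≤ t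
      lower-bound-⇔ d (z , a) =
        ⇔-trans (Lift-⇔ c)
          (subst (λ w → dur a + d ≤ t - s z ⇔ w ≤ t) (lower-regroup (dur a) d (s z))
            (≤-transposeʳ t (s z)))

      upper-bound-⇔ : ∀ u d p → clocks ⊨ (upperC dur u p +ᶜ d) ⇔ t ≤ termination p + d + u
      upper-bound-⇔ u d (z , a) =
        ⇔-trans (Lift-⇔ c)
          (subst (λ w → t - s z ≤ dur a + u + d ⇔ t ≤ w) (upper-regroup (dur a) u d (s z))
            (≤-transposeˡ (dur a + u + d) (s z)))

      lower-bounds-⇔ : ∀ E d {τ} → IsMax τ (map termination E) →
        clocks ⊨ (foldr₁ _∧_ (map (lowerC dur) E) +ᶜ d) ⇔ τ + d ≤ t
      lower-bounds-⇔ E d {τ} τ-max =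
        subst (λ φ → clocks ⊨ φ ⇔ τ + d ≤ t)
          (sym (delay-foldr₁ _∧_ d (λ _ _ → refl) (lowerC dur) E))
          (⇔-trans (⊨-⋀ clocks ((_+ᶜ d) ∘ lowerC dur) E)
            (⇔-trans every-bound
              (all-below-max termination E τ-max (_+ d) (+-mono-≤ d) t)))
        where
          every-bound : (∀ {p} → p ∈⁺ E → clocks ⊨ (lowerC dur p +ᶜ d)) ⇔
                        (∀ {p} → p ∈⁺ E → termination p + d ≤ t)
          every-bound = mk⇔ (λ h {p} p∈ → Equivalence.to   (lower-bound-⇔ d p) (h p∈))
                            (λ h {p} p∈ → Equivalence.from (lower-bound-⇔ d p) (h p∈))

      upper-bounds-⇔ : ∀ E u d {τ} → IsMax τ (map termination E) →
        clocks ⊨ (foldr₁ _∨_ (map (upperC dur u) E) +ᶜ d) ⇔ t ≤ τ + d + u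
      upper-bounds-⇔ E u d {τ} τ-max =
        subst (λ φ → clocks ⊨ φ ⇔ t ≤ τ + d + u)
          (sym (delay-foldr₁ _∨_ d (λ _ _ → refl) (upperC dur u) E))
          (⇔-trans (⊨-⋁ clocks ((_+ᶜ d) ∘ upperC dur u) E)
            (⇔-trans some-bound
              (some-above-max termination E τ-max (λ x → x + d + u)
                (+-mono-≤ u ∘ +-mono-≤ d) t)))
        where
          some-bound : (∃[ p ] (p ∈⁺ E × clocks ⊨ (upperC dur u p +ᶜ d))) ⇔
                       (∃[ p ] (p ∈⁺ E × t ≤ termination p + d + u))
          some-bound = mk⇔ (λ (p , p∈ , h) → p , p∈ , Equivalence.to   (upper-bound-⇔ u d p) h)
                           (λ (p , p∈ , h) → p , p∈ , Equivalence.from (upper-bound-⇔ u d p) h)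

lemma5p3 : ∀ {c ℓ} (O : OrderedTime c ℓ) → let open OrderedTime O in
    {Event Action : Set} → let open Timed O Event in
    (dur : Action → T) → (∀ a → Pos (dur a)) →
    (s : Event → T) →
    (E : List⁺ (Event × Action)) →
    (u d : T) → Pos u → Pos d →
    (τ : T) → IsMax τ (map (λ { (z , a) → s z + dur a }) E) →
    (t : T) → (∀ {z a} → (z , a) ∈⁺ E → s z ≤ t) →
    ((λ z → t - s z) ⊨ (F≤ dur u E +ᶜ d)) ⇔ ((τ + d ≤ t) × (t ≤ τ + d + u))
lemma5p3 O dur _ s E u d _ _ τ τ-max t _ =
  lower-bounds-⇔ O dur s t E d τ-max ×-⇔ upper-bounds-⇔ O dur s t E u d τ-max
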